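{- For every $n\ge 3$ and every $k$ with $1\le k\le n$, there exists a directed cycle graph $C_n$ on $n$ vertices such that $\operatorname{Pic}(C_n)\cong\mathbb{Z}\times\operatorname{Jac}(C_n)$ with $\operatorname{Jac}(C_n)\cong\mathbb{Z}_k$.
   Context: A directed cycle graph $C_n$ ($n\ge3$) is a directed graph whose underlying undirected graph is the cycle graph on $n$ vertices: vertices $v_1,\dots,v_n$ and, for each cyclically consecutive pair $v_i,v_{i+1}$ (indices mod $n$), exactly one arrow, which is either one-directional (in one of the two directions) or bi-directional. A bi-directional arrow between $v_i,v_j$ counts as an arrow from $v_i$ to $v_j$ and as one from $v_j$ to $v_i$. The Laplacian $L_G$ of a directed graph $G$ on $v_1,\dots,v_n$ is the $n\times n$ integer matrix with $(i,i)$ entry the number of outgoing arrows of $v_i$ and $(i,j)$ entry ($i\neq j$) minus the number of arrows from $v_i$ to $v_j$. $\operatorname{Pic}(G)=\mathbb{Z}^n/L_G^T\mathbb{Z}^n$, $\operatorname{Jac}(G)$ is its torsion subgroup, and $\mathbb{Z}_k=\mathbb{Z}/k\mathbb{Z}$ (so $\mathbb{Z}_1=0$). -}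

module Defs where

open import Data.Nat using (ℕ; zero; suc; NonZero)
open import Data.Nat.DivMod using (_mod_)
open import Data.Fin using (Fin; toℕ; _≟_)
import Data.Fin as F
open import Data.Integer using (ℤ; +_; _+_; _-_; _*_; -_)
open import Data.Integer.Divisibility using (_∣_)
open import Data.Product using (_×_; _,_; Σ; ∃; proj₁; proj₂)
open import Relation.Binary.PropositionalEquality using (_≡_)
open import Relation.Nullary using (yes; no; ¬_)

-- Type of the single arrow between v_i and v_{i+1} (indices mod n):
--   fwd  : v_i → v_{i+1},  bwd : v_{i+1} → v_i,  both : bi-directional.
data Arrow : Set where
  fwd bwd both : Arrow

-- A directed cycle graph on n vertices (vertices Fin n): for each i the
-- arrow between v_i and v_{i+1 mod n}.
DirCycle : ℕ → Set
DirCycle n = Fin n → Arrow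

next : ∀ {n} → Fin n → Fin n
next {suc m} i = suc (toℕ i) mod suc m

goesFwd : Arrow → ℕ
goesFwd fwd  = 1
goesFwd bwd  = 0
goesFwd both = 1

goesBwd : Arrow → ℕ
goesBwd fwd  = 0
goesBwd bwd  = 1
goesBwd both = 1

arrows : ∀ {n} → DirCycle n → Fin n → Fin n → ℕ
arrows {n} c i j = fromFwd Data.Nat.+ fromBwd
  where
  open import Data.Nat using (_+_)
  fromFwd : ℕ
  fromFwd with next i ≟ j
  ... | yes _ = goesFwd (c i)
  ... | no  _ = 0
  fromBwd : ℕ
  fromBwd with next j ≟ i
  ... | yes _ = goesBwd (c j)
  ... | no  _ = 0

sumℤ : ∀ n → (Fin n → ℤ) → ℤ
sumℤ zero    f = + 0
sumℤ (suc n) f = f F.zero + sumℤ n (λ i → f (F.suc i))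

sumℕ : ∀ n → (Fin n → ℕ) → ℕ
sumℕ zero    f = 0
sumℕ (suc n) f = f F.zero Data.Nat.+ sumℕ n (λ i → f (F.suc i))

outdeg : ∀ {n} → DirCycle n → Fin n → ℕ
outdeg {n} c i = sumℕ n (arrows c i)

laplacian : ∀ {n} → DirCycle n → Fin n → Fin n → ℤ
laplacian c i j with i ≟ j
... | yes _ = + outdeg c i
... | no  _ = - (+ arrows c i j)

ℤ^ : ℕ → Set
ℤ^ n = Fin n → ℤ

LT : ∀ {n} → DirCycle n → ℤ^ n → ℤ^ n
LT {n} c y i = sumℤ n (λ j → laplacian c j i * y j)

-- x lies in the image L_G^T ℤ^n  (i.e. x = 0 in Pic(G))
InImage : ∀ {n} → DirCycle n → ℤ^ n → Set
InImage {n} c x = Σ (ℤ^ n) λ y → ∀ i → x i ≡ LT c y i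

_⊕_ : ∀ {n} → ℤ^ n → ℤ^ n → ℤ^ n
(x ⊕ y) i = x i + y i

scale : ∀ {n} → ℕ → ℤ^ n → ℤ^ n
scale m x i = + m * x i

-- the class of x in Pic(G) is torsion, i.e. lies in Jac(G)
IsTorsion : ∀ {n} → DirCycle n → ℤ^ n → Set
IsTorsion c x = Σ ℕ λ m → ¬ (m ≡ 0) × InImage c (scale m x)

-- ℤ × ℤ_k, modelled as ℤ × ℤ with second coordinate taken modulo k
_≈[_]_ : ℤ × ℤ → ℕ → ℤ × ℤ → Set
(a , b) ≈[ k ] (a' , b') = (a ≡ a') × ((+ k) ∣ (b - b'))

_⊞_ : ℤ × ℤ → ℤ × ℤ → ℤ × ℤ
(a , b) ⊞ (a' , b') = (a + a' , b + b')

-- An isomorphism Pic(G) ≅ ℤ × ℤ_k, presented by a map φ : ℤ^n → ℤ × ℤ_k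
-- that is an additive homomorphism, surjective, and whose kernel is
-- exactly L_G^T ℤ^n (so φ descends to a bijective homomorphism on Pic(G)).
-- Additionally φ maps the torsion subgroup Jac(G) exactly onto 0 × ℤ_k,
-- so that it restricts to Jac(G) ≅ ℤ_k and Pic(G) ≅ ℤ × Jac(G).
record PicIso {n} (c : DirCycle n) (k : ℕ) : Set where
  field
    φ       : ℤ^ n → ℤ × ℤ
    hom     : ∀ x y → φ (x ⊕ y) ≈[ k ] (φ x ⊞ φ y)
    surj    : ∀ t → Σ (ℤ^ n) λ x → φ x ≈[ k ] t
    kerImg  : ∀ x → φ x ≈[ k ] (+ 0 , + 0) → InImage c x
    imgKer  : ∀ x → InImage c x → φ x ≈[ k ] (+ 0 , + 0)
    jacTo   : ∀ x → IsTorsion c x → proj₁ (φ x) ≡ + 0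
    jacFrom : ∀ x → proj₁ (φ x) ≡ + 0 → IsTorsion c x

module Submission where

-- Number the vertices 0, …, N.  For k ≥ 2 take the arrows a → a + 1 (a < N), made bidirectional
-- when a + 3 ≤ k, and close the cycle by 0 → N; for k = 1 take the plain directed cycle.  Pic(G)
-- is ℤ^n modulo the firing vectors (the rows of L_G).  Firing vertex a gives
-- e_{a+1} − e_a ≡ e_a − e_{a−1} when a also has a backward arrow (2 + a ≤ k; the backward
-- neighbour of 0 is N), and e_{a+1} ≡ e_a otherwise.  As e_0 − e_N is the first of these
-- differences, induction gives e_a − e_N ≡ min(a + 1, k) (e_0 − e_N), and a = N yields
-- k (e_0 − e_N) ≡ 0.  Hence x ↦ (Σ x, Σ_a min(a + 1, k) x_a mod k) is onto ℤ × ℤ_k and kills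
-- exactly the firing lattice (each firing changes the weighted sum by 0 or −k); a class is
-- torsion exactly when its degree Σ x vanishes.

open import Defs
open import Data.Bool using (T; true; false; if_then_else_)
open import Data.Empty using (⊥-elim)
open import Data.Fin using (Fin; zero; suc; toℕ; fromℕ; fromℕ<; inject₁)
import Data.Fin.Properties as FinP
open import Data.Integer using (ℤ; +_; 0ℤ; 1ℤ; _+_; _-_; _*_; -_)
open import Data.Integer.Divisibility.Signed
  using (_∣_; divides; ∣ᵤ⇒∣; ∣⇒∣ᵤ; ∣-refl; ∣m⇒∣m*n; ∣n⇒∣m*n; ∣m∣n⇒∣m+n)
import Data.Integer.Properties as ℤP
open import Algebra.Properties.Semiring.Sum ℤP.+-*-semiring
  using (sum; sum-cong-≗; sum-replicate-zero; ∑-distrib-+; ∑-comm; *-distribˡ-sum; *-distribʳ-sum)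
open import Data.Integer.Tactic.RingSolver using (solve-∀)
open import Data.Nat as ℕ using (ℕ; zero; suc; _≤_; _<_; z≤n; s≤s; _≡ᵇ_)
open import Data.Nat.DivMod using (_%_; m<n⇒m%n≡m; n%n≡0)
import Data.Nat.Properties as ℕP
open import Data.Product using (_×_; _,_; Σ; proj₁)
open import Data.Sum using (_⊎_; inj₁; inj₂)
open import Function using (_∘_)
open import Level using (0ℓ)
open import Relation.Binary.Bundles using (Setoid)
open import Relation.Binary.PropositionalEquality
import Relation.Binary.Reasoning.Setoid as SetoidReasoning
open import Relation.Nullary using (¬_; Dec; yes; no)

-- Integer vectors

sumℤ≡sum : ∀ n (f : Fin n → ℤ) → sumℤ n f ≡ sum f
sumℤ≡sum zero    f = refl
sumℤ≡sum (suc n) f = cong (λ s → f zero + s) (sumℤ≡sum n (f ∘ suc))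

sumℕ≡sum : ∀ n (f : Fin n → ℕ) → + sumℕ n f ≡ sum (λ i → + f i)
sumℕ≡sum zero    f = refl
sumℕ≡sum (suc n) f =
  trans (ℤP.pos-+ (f zero) _) (cong (λ s → + f zero + s) (sumℕ≡sum n (f ∘ suc)))

∣-sum : ∀ {n d} (f : ℤ^ n) → (∀ i → d ∣ f i) → d ∣ sum f
∣-sum {zero}  f _   = divides 0ℤ refl
∣-sum {suc n} f d∣f = ∣m∣n⇒∣m+n (d∣f zero) (∣-sum (f ∘ suc) (d∣f ∘ suc))

infixl 7 _·_
infixl 6 _⊖_

_·_ : ∀ {n} → ℤ → ℤ^ n → ℤ^ n
(a · x) i = a * x i

_⊖_ : ∀ {n} → ℤ^ n → ℤ^ n → ℤ^ n
(x ⊖ y) i = x i - y i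

𝟙 : ∀ {n} → ℤ^ n
𝟙 _ = 1ℤ

⟨_,_⟩ : ∀ {n} → ℤ^ n → ℤ^ n → ℤ
⟨ f , x ⟩ = sum (λ i → f i * x i)

combination : ∀ {l n} → (Fin l → ℤ) → (Fin l → ℤ^ n) → ℤ^ n
combination a v i = sum (λ j → a j * v j i)

-- The unit vector at the vertex with index a (the zero vector when a ≥ n).
δ : ∀ {n} → ℕ → ℤ^ n
δ a p = if toℕ p ≡ᵇ a then 1ℤ else 0ℤ

δ-same : ∀ {n} (p : Fin n) → δ (toℕ p) p ≡ 1ℤ
δ-same p with toℕ p ≡ᵇ toℕ p in eq
... | true  = refl
... | false = ⊥-elim (subst T eq (ℕP.≡⇒≡ᵇ (toℕ p) (toℕ p) refl))

δ-≢ : ∀ {n a} {p : Fin n} → toℕ p ≢ a → δ a p ≡ 0ℤ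
δ-≢ {a = a} {p} p≢a with toℕ p ≡ᵇ a in eq
... | true  = ⊥-elim (p≢a (ℕP.≡ᵇ⇒≡ (toℕ p) a (subst T (sym eq) _)))
... | false = refl

δ-yes : ∀ {n} {q p : Fin n} → q ≡ p → δ (toℕ q) p ≡ 1ℤ
δ-yes {p = p} refl = δ-same p

δ-no : ∀ {n} {q p : Fin n} → q ≢ p → δ (toℕ q) p ≡ 0ℤ
δ-no q≢p = δ-≢ (q≢p ∘ FinP.toℕ-injective ∘ sym)

δ-comm : ∀ {n} (q p : Fin n) → δ (toℕ q) p ≡ δ (toℕ p) q
δ-comm q p with q FinP.≟ p
... | yes refl = refl
... | no  q≢p  = trans (δ-no q≢p) (sym (δ-no (q≢p ∘ sym)))

⟨⟩-δ : ∀ {n a} (f : ℤ^ n) (a<n : a < n) → ⟨ f , δ a ⟩ ≡ f (fromℕ< a<n)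
⟨⟩-δ {suc n} {zero} f _ = begin
  f zero * 1ℤ + sum (λ p → f (suc p) * 0ℤ)
    ≡⟨ cong₂ _+_ (ℤP.*-identityʳ (f zero)) (sum-cong-≗ (ℤP.*-zeroʳ ∘ f ∘ suc)) ⟩
  f zero + sum {n} (λ _ → 0ℤ)
    ≡⟨ cong (λ s → f zero + s) (sum-replicate-zero n) ⟩
  f zero + 0ℤ
    ≡⟨ ℤP.+-identityʳ (f zero) ⟩
  f zero
    ∎
  where open ≡-Reasoning
⟨⟩-δ {suc n} {suc a} f (s≤s a<n) =
  trans (cong (_+ ⟨ f ∘ suc , δ a ⟩) (ℤP.*-zeroʳ (f zero)))
        (trans (ℤP.+-identityˡ _) (⟨⟩-δ (f ∘ suc) a<n))

⟨⟩-δ-toℕ : ∀ {n} (f : ℤ^ n) (q : Fin n) → ⟨ f , δ (toℕ q) ⟩ ≡ f q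
⟨⟩-δ-toℕ f q = trans (⟨⟩-δ f (FinP.toℕ<n q)) (cong f (FinP.fromℕ<-toℕ q _))

⟨⟩-cong : ∀ {n} (f : ℤ^ n) {x y : ℤ^ n} → x ≗ y → ⟨ f , x ⟩ ≡ ⟨ f , y ⟩
⟨⟩-cong f x≗y = sum-cong-≗ (λ i → cong (f i *_) (x≗y i))

⟨⟩-zeroʳ : ∀ {n} (f : ℤ^ n) → ⟨ f , (λ _ → 0ℤ) ⟩ ≡ 0ℤ
⟨⟩-zeroʳ {n} f = trans (sum-cong-≗ (ℤP.*-zeroʳ ∘ f)) (sum-replicate-zero n)

⟨⟩-⊕ : ∀ {n} (f x y : ℤ^ n) → ⟨ f , x ⊕ y ⟩ ≡ ⟨ f , x ⟩ + ⟨ f , y ⟩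
⟨⟩-⊕ f x y = trans (sum-cong-≗ (λ i → ℤP.*-distribˡ-+ (f i) (x i) (y i)))
                   (∑-distrib-+ (λ i → f i * x i) (λ i → f i * y i))

⟨⟩-· : ∀ {n} (f : ℤ^ n) a x → ⟨ f , a · x ⟩ ≡ a * ⟨ f , x ⟩
⟨⟩-· f a x = trans (sum-cong-≗ (λ i → reorder (f i) a (x i)))
                   (sym (*-distribˡ-sum a (λ i → f i * x i)))
  where
  reorder : ∀ u a v → u * (a * v) ≡ a * (u * v)
  reorder = solve-∀

⟨⟩-⊖ : ∀ {n} (f x y : ℤ^ n) → ⟨ f , x ⊖ y ⟩ ≡ ⟨ f , x ⟩ - ⟨ f , y ⟩
⟨⟩-⊖ f x y = begin
  ⟨ f , x ⊖ y ⟩                 ≡⟨ ⟨⟩-cong f (λ i → as-sum (x i) (y i)) ⟩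
  ⟨ f , x ⊕ (- 1ℤ · y) ⟩        ≡⟨ ⟨⟩-⊕ f x (- 1ℤ · y) ⟩
  ⟨ f , x ⟩ + ⟨ f , - 1ℤ · y ⟩  ≡⟨ cong (λ s → ⟨ f , x ⟩ + s) (⟨⟩-· f (- 1ℤ) y) ⟩
  ⟨ f , x ⟩ + - 1ℤ * ⟨ f , y ⟩  ≡⟨ sym (as-sum ⟨ f , x ⟩ ⟨ f , y ⟩) ⟩
  ⟨ f , x ⟩ - ⟨ f , y ⟩         ∎
  where
  open ≡-Reasoning
  as-sum : ∀ u v → u - v ≡ u + - 1ℤ * v
  as-sum = solve-∀

⟨⟩-combination : ∀ {l n} (f : ℤ^ n) (a : Fin l → ℤ) (v : Fin l → ℤ^ n) →
  ⟨ f , combination a v ⟩ ≡ sum (λ j → a j * ⟨ f , v j ⟩)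
⟨⟩-combination f a v = begin
  sum (λ i → f i * sum (λ j → a j * v j i))
    ≡⟨ sum-cong-≗ (λ i → *-distribˡ-sum (f i) (λ j → a j * v j i)) ⟩
  sum (λ i → sum (λ j → f i * (a j * v j i)))
    ≡⟨ ∑-comm (λ i j → f i * (a j * v j i)) ⟩
  sum (λ j → sum (λ i → f i * (a j * v j i)))
    ≡⟨ sum-cong-≗ (λ j → ⟨⟩-· f (a j) (v j)) ⟩
  sum (λ j → a j * ⟨ f , v j ⟩)
    ∎
  where open ≡-Reasoning

sum≡⟨𝟙,⟩ : ∀ {n} (x : ℤ^ n) → sum x ≡ ⟨ 𝟙 , x ⟩
sum≡⟨𝟙,⟩ x = sum-cong-≗ (λ i → sym (ℤP.*-identityˡ (x i)))

basis-expansion : ∀ {n} (x : ℤ^ n) → x ≗ combination x (δ ∘ toℕ)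
basis-expansion x p = sym (begin
  sum (λ i → x i * δ (toℕ i) p)  ≡⟨ sum-cong-≗ (λ i → cong (x i *_) (δ-comm i p)) ⟩
  ⟨ x , δ (toℕ p) ⟩              ≡⟨ ⟨⟩-δ-toℕ x p ⟩
  x p                            ∎)
  where open ≡-Reasoning

combination-affine : ∀ {l n} (a b : Fin l → ℤ) (u v : ℤ^ n) →
  combination a (λ i → u ⊕ (b i · v)) ≗ (sum a · u) ⊕ (⟨ b , a ⟩ · v)
combination-affine a b u v p = begin
  sum (λ i → a i * (u p + b i * v p))
    ≡⟨ sum-cong-≗ (λ i → expand (a i) (b i) (u p) (v p)) ⟩
  sum (λ i → a i * u p + (b i * a i) * v p)
    ≡⟨ ∑-distrib-+ (λ i → a i * u p) (λ i → (b i * a i) * v p) ⟩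
  sum (λ i → a i * u p) + sum (λ i → (b i * a i) * v p)
    ≡⟨ sym (cong₂ _+_ (*-distribʳ-sum (u p) a) (*-distribʳ-sum (v p) (λ i → b i * a i))) ⟩
  sum a * u p + ⟨ b , a ⟩ * v p
    ∎
  where
  open ≡-Reasoning
  expand : ∀ a b u v → a * (u + b * v) ≡ a * u + (b * a) * v
  expand = solve-∀

-- The cyclic order on Fin (suc m)

prevℕ : ℕ → ℕ → ℕ
prevℕ m zero    = m
prevℕ m (suc a) = a

prev : ∀ {m} → Fin (suc m) → Fin (suc m)
prev zero    = fromℕ _
prev (suc i) = inject₁ i

module _ {m : ℕ} where

  toℕ-next-< : (j : Fin (suc m)) → toℕ j < m → toℕ (next j) ≡ suc (toℕ j)
  toℕ-next-< j j<m = trans (FinP.toℕ-fromℕ< _) (m<n⇒m%n≡m (s≤s j<m))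

  toℕ-next-last : (j : Fin (suc m)) → toℕ j ≡ m → toℕ (next j) ≡ 0
  toℕ-next-last j j≡m = trans (FinP.toℕ-fromℕ< _)
    (subst (λ a → suc a % suc m ≡ 0) (sym j≡m) (n%n≡0 (suc m)))

  toℕ-prev : (j : Fin (suc m)) → toℕ (prev j) ≡ prevℕ m (toℕ j)
  toℕ-prev zero    = FinP.toℕ-fromℕ m
  toℕ-prev (suc i) = FinP.toℕ-inject₁ i

  next-prev : (j : Fin (suc m)) → next (prev j) ≡ j
  next-prev zero    = FinP.toℕ-injective (toℕ-next-last (fromℕ m) (FinP.toℕ-fromℕ m))
  next-prev (suc i) = FinP.toℕ-injective
    (trans (toℕ-next-< (inject₁ i) (subst (_< m) (sym (FinP.toℕ-inject₁ i)) (FinP.toℕ<n i)))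
           (cong suc (FinP.toℕ-inject₁ i)))

  prev-next : (j : Fin (suc m)) → prev (next j) ≡ j
  prev-next j with ℕP.m<1+n⇒m<n∨m≡n (FinP.toℕ<n j)
  ... | inj₁ j<m = FinP.toℕ-injective
    (trans (toℕ-prev (next j)) (cong (prevℕ m) (toℕ-next-< j j<m)))
  ... | inj₂ j≡m = FinP.toℕ-injective
    (trans (toℕ-prev (next j)) (trans (cong (prevℕ m) (toℕ-next-last j j≡m)) (sym j≡m)))

  next≡⇒≡prev : ∀ {p j : Fin (suc m)} → next p ≡ j → p ≡ prev j
  next≡⇒≡prev {p} refl = sym (prev-next p)

  prev≢ : 1 ≤ m → (j : Fin (suc m)) → prev j ≢ j
  prev≢ 1≤m zero    e = ℕP.<⇒≢ 1≤m (sym (trans (sym (FinP.toℕ-fromℕ m)) (cong toℕ e)))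
  prev≢ 1≤m (suc i) e = ℕP.1+n≢n (sym (trans (sym (FinP.toℕ-inject₁ i)) (cong toℕ e)))

  next≢ : 1 ≤ m → (j : Fin (suc m)) → next j ≢ j
  next≢ 1≤m j e = prev≢ 1≤m j (sym (next≡⇒≡prev e))

-- The Laplacian of a directed cycle

module _ {m : ℕ} (c : DirCycle (suc m)) where

  -- Row j of L_G: the change of divisor when j sends a chip along each of its outgoing arrows.
  fire : Fin (suc m) → ℤ^ (suc m)
  fire j = (+ goesFwd (c j) · (δ (toℕ j) ⊖ δ (toℕ (next j))))
         ⊕ (+ goesBwd (c (prev j)) · (δ (toℕ j) ⊖ δ (toℕ (prev j))))

  private
    split : ∀ {x y : ℕ} {u v : ℤ} → + x ≡ u → + y ≡ v → + (x ℕ.+ y) ≡ u + v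
    split {x} {y} eˣ eʸ = trans (ℤP.pos-+ x y) (cong₂ _+_ eˣ eʸ)

    forward-present : ∀ {j p} → next j ≡ p →
      + goesFwd (c j) ≡ + goesFwd (c j) * δ (toℕ (next j)) p
    forward-present {j} e =
      sym (trans (cong (+ goesFwd (c j) *_) (δ-yes e)) (ℤP.*-identityʳ (+ goesFwd (c j))))

    forward-absent : ∀ {j p} → next j ≢ p → 0ℤ ≡ + goesFwd (c j) * δ (toℕ (next j)) p
    forward-absent {j} e =
      sym (trans (cong (+ goesFwd (c j) *_) (δ-no e)) (ℤP.*-zeroʳ (+ goesFwd (c j))))

    backward-present : ∀ {j p} → next p ≡ j →
      + goesBwd (c p) ≡ + goesBwd (c (prev j)) * δ (toℕ (prev j)) p
    backward-present {j} {p} e with next≡⇒≡prev e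
    ... | refl = sym (trans (cong (+ goesBwd (c p) *_) (δ-same p)) (ℤP.*-identityʳ (+ goesBwd (c p))))

    backward-absent : ∀ {j p} → next p ≢ j → 0ℤ ≡ + goesBwd (c (prev j)) * δ (toℕ (prev j)) p
    backward-absent {j} e = sym (trans
      (cong (+ goesBwd (c (prev j)) *_) (δ-no (λ prev≡p → e (trans (cong next (sym prev≡p)) (next-prev j)))))
      (ℤP.*-zeroʳ (+ goesBwd (c (prev j)))))

  arrows-cycle : ∀ j p → + arrows c j p ≡
    + goesFwd (c j) * δ (toℕ (next j)) p + + goesBwd (c (prev j)) * δ (toℕ (prev j)) p
  arrows-cycle j p with next j FinP.≟ p | next p FinP.≟ j
  ... | yes e₁ | yes e₂ = split (forward-present e₁) (backward-present e₂)
  ... | yes e₁ | no  e₂ = split (forward-present e₁) (backward-absent e₂)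
  ... | no  e₁ | yes e₂ = split (forward-absent e₁) (backward-present e₂)
  ... | no  e₁ | no  e₂ = split (forward-absent e₁) (backward-absent e₂)

  outdeg-cycle : ∀ j → + outdeg c j ≡ + goesFwd (c j) + + goesBwd (c (prev j))
  outdeg-cycle j = begin
    + outdeg c j
      ≡⟨ sumℕ≡sum (suc m) (arrows c j) ⟩
    sum (λ p → + arrows c j p)
      ≡⟨ sum-cong-≗ (arrows-cycle j) ⟩
    sum (λ p → A * forward p + B * backward p)
      ≡⟨ ∑-distrib-+ (λ p → A * forward p) (λ p → B * backward p) ⟩
    ⟨ const A , forward ⟩ + ⟨ const B , backward ⟩
      ≡⟨ cong₂ _+_ (⟨⟩-δ-toℕ (const A) (next j)) (⟨⟩-δ-toℕ (const B) (prev j)) ⟩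
    A + B
      ∎
    where
    open ≡-Reasoning
    A = + goesFwd (c j)
    B = + goesBwd (c (prev j))
    forward backward : ℤ^ (suc m)
    forward  = δ (toℕ (next j))
    backward = δ (toℕ (prev j))
    const : ℤ → ℤ^ (suc m)
    const a _ = a

  laplacian≡fire : 1 ≤ m → ∀ j p → laplacian c j p ≡ fire j p
  laplacian≡fire 1≤m j p with j FinP.≟ p
  ... | yes refl = begin
    + outdeg c j
      ≡⟨ outdeg-cycle j ⟩
    A + B
      ≡⟨ diagonal A B ⟩
    A * (1ℤ - 0ℤ) + B * (1ℤ - 0ℤ)
      ≡⟨ sym (cong₂ (λ u v → A * (1ℤ - u) + B * (1ℤ - v)) (δ-no (next≢ 1≤m j)) (δ-no (prev≢ 1≤m j))) ⟩
    A * (1ℤ - δ (toℕ (next j)) j) + B * (1ℤ - δ (toℕ (prev j)) j)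
      ≡⟨ sym (cong (λ u → A * (u - δ (toℕ (next j)) j) + B * (u - δ (toℕ (prev j)) j)) (δ-same j)) ⟩
    fire j j
      ∎
    where
    open ≡-Reasoning
    A = + goesFwd (c j)
    B = + goesBwd (c (prev j))
    diagonal : ∀ a b → a + b ≡ a * (1ℤ - 0ℤ) + b * (1ℤ - 0ℤ)
    diagonal = solve-∀
  ... | no j≢p = begin
    - + arrows c j p                ≡⟨ cong -_ (arrows-cycle j p) ⟩
    - (A * d₁ + B * d₂)             ≡⟨ off-diagonal A B d₁ d₂ ⟩
    A * (0ℤ - d₁) + B * (0ℤ - d₂)   ≡⟨ sym (cong (λ u → A * (u - d₁) + B * (u - d₂)) (δ-no j≢p)) ⟩
    fire j p                        ∎
    where
    open ≡-Reasoning
    A = + goesFwd (c j)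
    B = + goesBwd (c (prev j))
    d₁ = δ (toℕ (next j)) p
    d₂ = δ (toℕ (prev j)) p
    off-diagonal : ∀ a b x y → - (a * x + b * y) ≡ a * (0ℤ - x) + b * (0ℤ - y)
    off-diagonal = solve-∀

  fire-shape : ∀ j {A B a b} → + goesFwd (c j) ≡ A → + goesBwd (c (prev j)) ≡ B →
    toℕ (next j) ≡ a → toℕ (prev j) ≡ b →
    fire j ≗ (A · (δ (toℕ j) ⊖ δ a)) ⊕ (B · (δ (toℕ j) ⊖ δ b))
  fire-shape j refl refl refl refl _ = refl

  LT≗combination-fire : 1 ≤ m → ∀ y → LT c y ≗ combination y fire
  LT≗combination-fire 1≤m y i = trans (sumℤ≡sum (suc m) (λ j → laplacian c j i * y j))
    (sum-cong-≗ (λ j → trans (ℤP.*-comm (laplacian c j i) (y j)) (cong (y j *_) (laplacian≡fire 1≤m j i))))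

  ⟨⟩-LT : 1 ≤ m → ∀ f y → ⟨ f , LT c y ⟩ ≡ sum (λ j → y j * ⟨ f , fire j ⟩)
  ⟨⟩-LT 1≤m f y = trans (⟨⟩-cong f (LT≗combination-fire 1≤m y)) (⟨⟩-combination f y fire)

  ⟨⟩-fire : ∀ (f : ℤ^ (suc m)) j → ⟨ f , fire j ⟩ ≡
    + goesFwd (c j) * (f j - f (next j)) + + goesBwd (c (prev j)) * (f j - f (prev j))
  ⟨⟩-fire f j = begin
    ⟨ f , fire j ⟩
      ≡⟨ ⟨⟩-⊕ f (A · (e j ⊖ e (next j))) (B · (e j ⊖ e (prev j))) ⟩
    ⟨ f , A · (e j ⊖ e (next j)) ⟩ + ⟨ f , B · (e j ⊖ e (prev j)) ⟩
      ≡⟨ cong₂ _+_ (⟨⟩-· f A (e j ⊖ e (next j))) (⟨⟩-· f B (e j ⊖ e (prev j))) ⟩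
    A * ⟨ f , e j ⊖ e (next j) ⟩ + B * ⟨ f , e j ⊖ e (prev j) ⟩
      ≡⟨ cong₂ (λ u v → A * u + B * v) (pairing (next j)) (pairing (prev j)) ⟩
    A * (f j - f (next j)) + B * (f j - f (prev j))
      ∎
    where
    open ≡-Reasoning
    A = + goesFwd (c j)
    B = + goesBwd (c (prev j))
    e : Fin (suc m) → ℤ^ (suc m)
    e = δ ∘ toℕ
    pairing : ∀ q → ⟨ f , e j ⊖ e q ⟩ ≡ f j - f q
    pairing q = trans (⟨⟩-⊖ f (e j) (e q)) (cong₂ _-_ (⟨⟩-δ-toℕ f j) (⟨⟩-δ-toℕ f q))

  sum-LT : 1 ≤ m → ∀ y → sum (LT c y) ≡ 0ℤ
  sum-LT 1≤m y = begin
    sum (LT c y)                       ≡⟨ sum≡⟨𝟙,⟩ (LT c y) ⟩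
    ⟨ 𝟙 , LT c y ⟩                     ≡⟨ ⟨⟩-LT 1≤m 𝟙 y ⟩
    sum (λ j → y j * ⟨ 𝟙 , fire j ⟩)   ≡⟨ sum-cong-≗ (λ j → cong (y j *_) (degree-fire j)) ⟩
    sum (λ j → y j * 0ℤ)               ≡⟨ sum-cong-≗ (ℤP.*-zeroʳ ∘ y) ⟩
    sum {suc m} (λ _ → 0ℤ)             ≡⟨ sum-replicate-zero (suc m) ⟩
    0ℤ                                 ∎
    where
    open ≡-Reasoning
    balanced : ∀ a b → a * (1ℤ - 1ℤ) + b * (1ℤ - 1ℤ) ≡ 0ℤ
    balanced = solve-∀
    degree-fire : ∀ j → ⟨ 𝟙 , fire j ⟩ ≡ 0ℤ
    degree-fire j = trans (⟨⟩-fire 𝟙 j) (balanced (+ goesFwd (c j)) (+ goesBwd (c (prev j))))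

-- The image of L_Gᵀ and congruence modulo it

module Image {n : ℕ} (c : DirCycle n) where

  LT-sum : ∀ y i → LT c y i ≡ sum (λ j → laplacian c j i * y j)
  LT-sum y i = sumℤ≡sum n (λ j → laplacian c j i * y j)

  LT-⊕ : ∀ y y' → LT c (y ⊕ y') ≗ LT c y ⊕ LT c y'
  LT-⊕ y y' i = begin
    LT c (y ⊕ y') i                                  ≡⟨ LT-sum (y ⊕ y') i ⟩
    sum (λ j → L j * (y j + y' j))                   ≡⟨ sum-cong-≗ (λ j → ℤP.*-distribˡ-+ (L j) (y j) (y' j)) ⟩
    sum (λ j → L j * y j + L j * y' j)               ≡⟨ ∑-distrib-+ (λ j → L j * y j) (λ j → L j * y' j) ⟩
    sum (λ j → L j * y j) + sum (λ j → L j * y' j)   ≡⟨ sym (cong₂ _+_ (LT-sum y i) (LT-sum y' i)) ⟩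
    LT c y i + LT c y' i                             ∎
    where
    open ≡-Reasoning
    L : Fin n → ℤ
    L j = laplacian c j i

  LT-· : ∀ s y → LT c (s · y) ≗ s · LT c y
  LT-· s y i = begin
    LT c (s · y) i                ≡⟨ LT-sum (s · y) i ⟩
    sum (λ j → L j * (s * y j))   ≡⟨ sum-cong-≗ (λ j → reorder (L j) s (y j)) ⟩
    sum (λ j → s * (L j * y j))   ≡⟨ sym (*-distribˡ-sum s (λ j → L j * y j)) ⟩
    s * sum (λ j → L j * y j)     ≡⟨ cong (s *_) (sym (LT-sum y i)) ⟩
    s * LT c y i                  ∎
    where
    open ≡-Reasoning
    L : Fin n → ℤ
    L j = laplacian c j i
    reorder : ∀ l s y → l * (s * y) ≡ s * (l * y)
    reorder = solve-∀

  LT-δ : ∀ j → LT c (δ (toℕ j)) ≗ laplacian c j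
  LT-δ j i = trans (LT-sum (δ (toℕ j)) i) (⟨⟩-δ-toℕ (λ j' → laplacian c j' i) j)

  InImage-resp : ∀ {x y} → x ≗ y → InImage c x → InImage c y
  InImage-resp x≗y (z , x≗LTz) = z , λ i → trans (sym (x≗y i)) (x≗LTz i)

  InImage-0 : InImage c (λ _ → 0ℤ)
  InImage-0 = (λ _ → 0ℤ) , λ i → sym (trans (LT-sum (λ _ → 0ℤ) i) (⟨⟩-zeroʳ (λ j → laplacian c j i)))

  InImage-⊕ : ∀ {x y} → InImage c x → InImage c y → InImage c (x ⊕ y)
  InImage-⊕ (z , x≗) (z' , y≗) = z ⊕ z' , λ i → trans (cong₂ _+_ (x≗ i) (y≗ i)) (sym (LT-⊕ z z' i))

  InImage-· : ∀ s {x} → InImage c x → InImage c (s · x)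
  InImage-· s (z , x≗) = s · z , λ i → trans (cong (s *_) (x≗ i)) (sym (LT-· s z i))

  InImage-laplacian : ∀ j → InImage c (laplacian c j)
  InImage-laplacian j = δ (toℕ j) , λ i → sym (LT-δ j i)

  infix 4 _≋_

  record _≋_ (x y : ℤ^ n) : Set where
    constructor ≋-from-image
    field image : InImage c (x ⊖ y)

  ≋0⇒InImage : ∀ {x} → x ≋ (λ _ → 0ℤ) → InImage c x
  ≋0⇒InImage (≋-from-image x∈) = InImage-resp (λ i → ℤP.+-identityʳ _) x∈

  ≗⇒≋ : ∀ {x y} → x ≗ y → x ≋ y
  ≗⇒≋ {x} {y} x≗y = ≋-from-image
    (InImage-resp (λ i → sym (trans (cong (_- y i) (x≗y i)) (ℤP.+-inverseʳ (y i)))) InImage-0)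

  ≋-by-image : ∀ s {u v x} → InImage c x → (∀ p → u p - v p ≡ s * x p) → u ≋ v
  ≋-by-image s x∈ u⊖v≗sx = ≋-from-image (InImage-resp (sym ∘ u⊖v≗sx) (InImage-· s x∈))

  ≋-sym : ∀ {x y} → x ≋ y → y ≋ x
  ≋-sym {x} {y} (≋-from-image d) =
    ≋-from-image (InImage-resp (λ i → negate (x i) (y i)) (InImage-· (- 1ℤ) d))
    where
    negate : ∀ u v → - 1ℤ * (u - v) ≡ v - u
    negate = solve-∀

  ≋-trans : ∀ {x y z} → x ≋ y → y ≋ z → x ≋ z
  ≋-trans {x} {y} {z} (≋-from-image d) (≋-from-image d') =
    ≋-from-image (InImage-resp (λ i → telescope (x i) (y i) (z i)) (InImage-⊕ d d'))
    where
    telescope : ∀ u v w → (u - v) + (v - w) ≡ u - w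
    telescope = solve-∀

  ≋-setoid : Setoid 0ℓ 0ℓ
  ≋-setoid = record
    { Carrier       = ℤ^ n
    ; _≈_           = _≋_
    ; isEquivalence = record { refl = ≗⇒≋ (λ _ → refl) ; sym = ≋-sym ; trans = ≋-trans }
    }

  ⊕-cong : ∀ {x x' y y'} → x ≋ x' → y ≋ y' → x ⊕ y ≋ x' ⊕ y'
  ⊕-cong {x} {x'} {y} {y'} (≋-from-image d) (≋-from-image d') =
    ≋-from-image (InImage-resp (λ i → regroup (x i) (x' i) (y i) (y' i)) (InImage-⊕ d d'))
    where
    regroup : ∀ u u' v v' → (u - u') + (v - v') ≡ (u + v) - (u' + v')
    regroup = solve-∀

  ·-cong : ∀ s {x y} → x ≋ y → s · x ≋ s · y
  ·-cong s {x} {y} (≋-from-image d) =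
    ≋-from-image (InImage-resp (λ i → distrib s (x i) (y i)) (InImage-· s d))
    where
    distrib : ∀ s u v → s * (u - v) ≡ s * u - s * v
    distrib = solve-∀

  combination-cong : ∀ {l} (a : Fin l → ℤ) {u v : Fin l → ℤ^ n} →
    (∀ j → u j ≋ v j) → combination a u ≋ combination a v
  combination-cong {zero}  a u≋v = ≗⇒≋ (λ _ → refl)
  combination-cong {suc l} a u≋v =
    ⊕-cong (·-cong (a zero) (u≋v zero)) (combination-cong (a ∘ suc) (u≋v ∘ suc))

picIso-from-character : ∀ {n} (c : DirCycle n) k → k ≢ 0 → (w : ℤ^ n) →
  (∀ {x} → InImage c x → sum x ≡ 0ℤ × + k ∣ ⟨ w , x ⟩) →
  (∀ {x} → sum x ≡ 0ℤ → + k ∣ ⟨ w , x ⟩ → InImage c x) →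
  (∀ a b → Σ (ℤ^ n) λ x → sum x ≡ a × + k ∣ ⟨ w , x ⟩ - b) →
  PicIso c k
picIso-from-character c k k≢0 w image⇒ ⇒image onto = record
  { φ       = λ x → sum x , ⟨ w , x ⟩
  ; hom     = λ x y → ∑-distrib-+ x y , ∣⇒∣ᵤ {+ k} (divides 0ℤ (additive x y))
  ; surj    = λ (a , b) → let (x , sum≡a , k∣) = onto a b in x , sum≡a , ∣⇒∣ᵤ k∣
  ; kerImg  = λ x (sum≡0 , k∣) → ⇒image sum≡0 (subst (+ k ∣_) (ℤP.+-identityʳ _) (∣ᵤ⇒∣ k∣))
  ; imgKer  = λ x x∈ → let (sum≡0 , k∣) = image⇒ x∈ in
                sum≡0 , ∣⇒∣ᵤ (subst (+ k ∣_) (sym (ℤP.+-identityʳ _)) k∣)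
  ; jacTo   = λ x (m , m≢0 , mx∈) →
                cancel m≢0 (trans (*-distribˡ-sum (+ m) x) (proj₁ (image⇒ mx∈)))
  ; jacFrom = λ x sum≡0 → k , k≢0 , ⇒image
                (trans (sym (*-distribˡ-sum (+ k) x)) (trans (cong (+ k *_) sum≡0) (ℤP.*-zeroʳ (+ k))))
                (subst (+ k ∣_) (sym (⟨⟩-· w (+ k) x)) (∣m⇒∣m*n ⟨ w , x ⟩ ∣-refl))
  }
  where
  additive : ∀ x y → ⟨ w , x ⊕ y ⟩ - (⟨ w , x ⟩ + ⟨ w , y ⟩) ≡ 0ℤ
  additive x y = trans (cong (_- (⟨ w , x ⟩ + ⟨ w , y ⟩)) (⟨⟩-⊕ w x y))
                       (ℤP.+-inverseʳ (⟨ w , x ⟩ + ⟨ w , y ⟩))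
  cancel : ∀ {m s} → m ≢ 0 → + m * s ≡ 0ℤ → s ≡ 0ℤ
  cancel {m} m≢0 ms≡0 with ℤP.i*j≡0⇒i≡0∨j≡0 (+ m) ms≡0
  ... | inj₁ m≡0 = ⊥-elim (m≢0 (ℤP.+-injective m≡0))
  ... | inj₂ s≡0 = s≡0

-- The cycle realising ℤ × ℤ_k

module Construction (N k : ℕ) (1≤N : 1 ≤ N) (1≤k : 1 ≤ k) (k≤1+N : k ≤ suc N) where

  arrow : ℕ → Arrow
  arrow a with a ℕ.<? N | 3 ℕ.+ a ℕ.≤? k | 2 ℕ.≤? k
  ... | yes _ | yes _ | _     = both
  ... | yes _ | no  _ | _     = fwd
  ... | no  _ | _     | yes _ = bwd
  ... | no  _ | _     | no  _ = fwd

  cycle : DirCycle (suc N)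
  cycle j = arrow (toℕ j)

  forward-below : ∀ {a} → a < N → goesFwd (arrow a) ≡ 1
  forward-below {a} a<N with a ℕ.<? N | 3 ℕ.+ a ℕ.≤? k | 2 ℕ.≤? k
  ... | yes _  | yes _ | _ = refl
  ... | yes _  | no  _ | _ = refl
  ... | no a≮N | _     | _ = ⊥-elim (a≮N a<N)

  forward-last : 2 ≤ k → goesFwd (arrow N) ≡ 0
  forward-last 2≤k with N ℕ.<? N | 3 ℕ.+ N ℕ.≤? k | 2 ℕ.≤? k
  ... | yes N<N | _ | _      = ⊥-elim (ℕP.<-irrefl refl N<N)
  ... | no _    | _ | yes _  = refl
  ... | no _    | _ | no k≱2 = ⊥-elim (k≱2 2≤k)

  backward-into : ∀ {a} → 2 ℕ.+ a ≤ k → goesBwd (arrow (prevℕ N a)) ≡ 1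
  backward-into {zero} 2≤k with N ℕ.<? N | 3 ℕ.+ N ℕ.≤? k | 2 ℕ.≤? k
  ... | yes N<N | _ | _      = ⊥-elim (ℕP.<-irrefl refl N<N)
  ... | no _    | _ | yes _  = refl
  ... | no _    | _ | no k≱2 = ⊥-elim (k≱2 2≤k)
  backward-into {suc b} 3+b≤k with b ℕ.<? N | 3 ℕ.+ b ℕ.≤? k | 2 ℕ.≤? k
  ... | yes _  | yes _     | _ = refl
  ... | yes _  | no 3+b≰k  | _ = ⊥-elim (3+b≰k 3+b≤k)
  ... | no b≮N | _         | _ =
    ⊥-elim (b≮N (ℕP.≤-pred (ℕP.≤-trans (ℕP.n≤1+n _) (ℕP.≤-trans 3+b≤k k≤1+N))))

  no-backward-into : ∀ {a} → a ≤ N → ¬ (2 ℕ.+ a ≤ k) → goesBwd (arrow (prevℕ N a)) ≡ 0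
  no-backward-into {zero} _ k≱2 with N ℕ.<? N | 3 ℕ.+ N ℕ.≤? k | 2 ℕ.≤? k
  ... | yes N<N | _ | _       = ⊥-elim (ℕP.<-irrefl refl N<N)
  ... | no _    | _ | yes 2≤k = ⊥-elim (k≱2 2≤k)
  ... | no _    | _ | no _    = refl
  no-backward-into {suc b} 1+b≤N 3+b≰k with b ℕ.<? N | 3 ℕ.+ b ℕ.≤? k | 2 ℕ.≤? k
  ... | yes _  | yes 3+b≤k | _ = ⊥-elim (3+b≰k 3+b≤k)
  ... | yes _  | no _      | _ = refl
  ... | no b≮N | _         | _ = ⊥-elim (b≮N 1+b≤N)

  backward-arrow : ∀ j {B} → goesBwd (arrow (prevℕ N (toℕ j))) ≡ B → + goesBwd (cycle (prev j)) ≡ + B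
  backward-arrow j refl = cong (+_ ∘ goesBwd ∘ arrow) (toℕ-prev j)

  fire-forward : ∀ j {a} → toℕ j ≡ a → a < N → ¬ (2 ℕ.+ a ≤ k) → fire cycle j ≗ δ a ⊖ δ (suc a)
  fire-forward j refl a<N flat p = trans
    (fire-shape cycle j (cong +_ (forward-below a<N))
      (backward-arrow j (no-backward-into (ℕP.<⇒≤ a<N) flat)) (toℕ-next-< j a<N) refl p)
    (only-forward (δ (toℕ j) p) (δ (suc (toℕ j)) p) (δ (toℕ (prev j)) p))
    where
    only-forward : ∀ x y z → 1ℤ * (x - y) + 0ℤ * (x - z) ≡ x - y
    only-forward = solve-∀

  fire-both : ∀ j {a} → toℕ j ≡ a → 2 ℕ.+ a ≤ k →
    fire cycle j ≗ (δ a ⊖ δ (suc a)) ⊕ (δ a ⊖ δ (prevℕ N a))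
  fire-both j refl rise p = trans
    (fire-shape cycle j (cong +_ (forward-below a<N))
      (backward-arrow j (backward-into rise)) (toℕ-next-< j a<N) (toℕ-prev j) p)
    (both-ways (δ (toℕ j) p) (δ (suc (toℕ j)) p) (δ (prevℕ N (toℕ j)) p))
    where
    a<N : toℕ j < N
    a<N = ℕP.≤-pred (ℕP.≤-trans rise k≤1+N)
    both-ways : ∀ x y z → 1ℤ * (x - y) + 1ℤ * (x - z) ≡ (x - y) + (x - z)
    both-ways = solve-∀

  fire-last : ∀ j → toℕ j ≡ N → 2 ≤ k → fire cycle j ≗ (λ _ → 0ℤ)
  fire-last j j≡N 2≤k = fire-shape cycle j
    (trans (cong (+_ ∘ goesFwd ∘ arrow) j≡N) (cong +_ (forward-last 2≤k)))
    (backward-arrow j (no-backward-into (ℕP.≤-pred (FinP.toℕ<n j))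
      (ℕP.<⇒≱ (s≤s k≤1+N) ∘ subst (λ a → 2 ℕ.+ a ≤ k) j≡N)))
    refl refl

  weight : ℕ → ℕ
  weight a = suc a ℕ.⊓ k

  w : ℤ^ (suc N)
  w p = + weight (toℕ p)

  increment : ℕ → ℤ
  increment a = + weight (suc a) - + weight a

  weight-below : ∀ {a} → suc a ≤ k → weight a ≡ suc a
  weight-below = ℕP.m≤n⇒m⊓n≡m

  weight-above : ∀ {a} → k ≤ suc a → weight a ≡ k
  weight-above = ℕP.m≥n⇒m⊓n≡n

  increment-rise : ∀ {a} → 2 ℕ.+ a ≤ k → increment a ≡ 1ℤ
  increment-rise {a} rise = begin
    + weight (suc a) - + weight a
      ≡⟨ cong₂ (λ u v → + u - + v) (weight-below rise) (weight-below (ℕP.≤-trans (ℕP.n≤1+n _) rise)) ⟩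
    + suc (suc a) - + suc a
      ≡⟨ cong (_- + suc a) (ℤP.pos-+ 1 (suc a)) ⟩
    1ℤ + + suc a - + suc a
      ≡⟨ cancel (+ suc a) ⟩
    1ℤ
      ∎
    where
    open ≡-Reasoning
    cancel : ∀ x → 1ℤ + x - x ≡ 1ℤ
    cancel = solve-∀

  increment-flat : ∀ {a} → ¬ (2 ℕ.+ a ≤ k) → increment a ≡ 0ℤ
  increment-flat {a} flat = begin
    + weight (suc a) - + weight a
      ≡⟨ cong₂ (λ u v → + u - + v) (weight-above (ℕP.≤-trans k≤1+a (ℕP.n≤1+n _))) (weight-above k≤1+a) ⟩
    + k - + k
      ≡⟨ ℤP.+-inverseʳ (+ k) ⟩
    0ℤ
      ∎
    where
    open ≡-Reasoning
    k≤1+a : k ≤ suc a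
    k≤1+a = ℕP.≤-pred (ℕP.≰⇒> flat)

  ⟨w,δ⟩ : ∀ {a} → a ≤ N → ⟨ w , δ a ⟩ ≡ + weight a
  ⟨w,δ⟩ a≤N = trans (⟨⟩-δ w (s≤s a≤N)) (cong (+_ ∘ weight) (FinP.toℕ-fromℕ< _))

  ⟨w,δ⊖δ⟩ : ∀ {a b} → a ≤ N → b ≤ N → ⟨ w , δ a ⊖ δ b ⟩ ≡ + weight a - + weight b
  ⟨w,δ⊖δ⟩ {a} {b} a≤N b≤N = trans (⟨⟩-⊖ w (δ a) (δ b)) (cong₂ _-_ (⟨w,δ⟩ a≤N) (⟨w,δ⟩ b≤N))

  ⟨w,forward⟩ : ∀ {a} → a < N → ⟨ w , δ a ⊖ δ (suc a) ⟩ ≡ - increment a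
  ⟨w,forward⟩ {a} a<N = trans (⟨w,δ⊖δ⟩ (ℕP.<⇒≤ a<N) a<N) (flip (+ weight a) (+ weight (suc a)))
    where
    flip : ∀ x y → x - y ≡ - (y - x)
    flip = solve-∀

  weighted-rise : ∀ a → 2 ℕ.+ a ≤ k → + k ∣ ⟨ w , (δ a ⊖ δ (suc a)) ⊕ (δ a ⊖ δ (prevℕ N a)) ⟩
  weighted-rise zero 2≤k = divides (- 1ℤ) (begin
    ⟨ w , (δ 0 ⊖ δ 1) ⊕ (δ 0 ⊖ δ N) ⟩
      ≡⟨ ⟨⟩-⊕ w (δ 0 ⊖ δ 1) (δ 0 ⊖ δ N) ⟩
    ⟨ w , δ 0 ⊖ δ 1 ⟩ + ⟨ w , δ 0 ⊖ δ N ⟩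
      ≡⟨ cong₂ _+_ (⟨w,forward⟩ 1≤N) (⟨w,δ⊖δ⟩ z≤n ℕP.≤-refl) ⟩
    - increment 0 + (+ weight 0 - + weight N)
      ≡⟨ cong₂ (λ i u → - i + (+ u - + weight N)) (increment-rise 2≤k) (weight-below 1≤k) ⟩
    - 1ℤ + (1ℤ - + weight N)
      ≡⟨ cong (λ u → - 1ℤ + (1ℤ - + u)) (weight-above k≤1+N) ⟩
    - 1ℤ + (1ℤ - + k)
      ≡⟨ wrap-around (+ k) ⟩
    - 1ℤ * + k
      ∎)
    where
    open ≡-Reasoning
    wrap-around : ∀ x → - 1ℤ + (1ℤ - x) ≡ - 1ℤ * x
    wrap-around = solve-∀
  weighted-rise (suc b) 3+b≤k = divides 0ℤ (begin
    ⟨ w , (δ (suc b) ⊖ δ (2 ℕ.+ b)) ⊕ (δ (suc b) ⊖ δ b) ⟩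
      ≡⟨ ⟨⟩-⊕ w (δ (suc b) ⊖ δ (2 ℕ.+ b)) (δ (suc b) ⊖ δ b) ⟩
    ⟨ w , δ (suc b) ⊖ δ (2 ℕ.+ b) ⟩ + ⟨ w , δ (suc b) ⊖ δ b ⟩
      ≡⟨ cong₂ _+_ (⟨w,forward⟩ 1+b<N) (⟨w,δ⊖δ⟩ (ℕP.<⇒≤ 1+b<N) (ℕP.<⇒≤ (ℕP.<⇒≤ 1+b<N))) ⟩
    - increment (suc b) + increment b
      ≡⟨ cong₂ (λ u v → - u + v) (increment-rise 3+b≤k) (increment-rise (ℕP.≤-trans (ℕP.n≤1+n _) 3+b≤k)) ⟩
    - 1ℤ + 1ℤ
      ∎)
    where
    open ≡-Reasoning
    1+b<N : suc b < N
    1+b<N = ℕP.≤-pred (ℕP.≤-trans 3+b≤k k≤1+N)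

  weighted-fire : ∀ j → + k ∣ ⟨ w , fire cycle j ⟩
  weighted-fire j = cases (2 ℕ.≤? k) (ℕP.m<1+n⇒m<n∨m≡n (FinP.toℕ<n j)) (2 ℕ.+ toℕ j ℕ.≤? k)
    where
    open ≡-Reasoning
    cases : Dec (2 ≤ k) → toℕ j < N ⊎ toℕ j ≡ N → Dec (2 ℕ.+ toℕ j ≤ k) → + k ∣ ⟨ w , fire cycle j ⟩
    cases (no k≱2) _ _ = subst (λ d → + d ∣ ⟨ w , fire cycle j ⟩)
      (ℕP.≤-antisym 1≤k (ℕP.≤-pred (ℕP.≰⇒> k≱2)))
      (divides ⟨ w , fire cycle j ⟩ (sym (ℤP.*-identityʳ _)))
    cases (yes 2≤k) (inj₂ j≡N) _ =
      divides 0ℤ (trans (⟨⟩-cong w (fire-last j j≡N 2≤k)) (⟨⟩-zeroʳ w))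
    cases _ (inj₁ j<N) (yes rise) =
      subst (+ k ∣_) (sym (⟨⟩-cong w (fire-both j refl rise))) (weighted-rise (toℕ j) rise)
    cases _ (inj₁ j<N) (no flat) = divides 0ℤ (begin
      ⟨ w , fire cycle j ⟩                  ≡⟨ ⟨⟩-cong w (fire-forward j refl j<N flat) ⟩
      ⟨ w , δ (toℕ j) ⊖ δ (suc (toℕ j)) ⟩   ≡⟨ ⟨w,forward⟩ j<N ⟩
      - increment (toℕ j)                   ≡⟨ cong -_ (increment-flat flat) ⟩
      0ℤ                                    ∎)

  image⇒character : ∀ {x} → InImage cycle x → sum x ≡ 0ℤ × + k ∣ ⟨ w , x ⟩
  image⇒character {x} (y , x≗LTy) =
    trans (sum-cong-≗ x≗LTy) (sum-LT cycle 1≤N y) ,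
    subst (+ k ∣_) (sym (trans (⟨⟩-cong w x≗LTy) (⟨⟩-LT cycle 1≤N w y)))
      (∣-sum _ (λ j → ∣n⇒∣m*n (y j) (weighted-fire j)))

  open Image cycle

  t₀ : ℤ^ (suc N)
  t₀ = δ 0 ⊖ δ N

  fire-in-image : ∀ j → InImage cycle (fire cycle j)
  fire-in-image j = InImage-resp (laplacian≡fire cycle 1≤N j) (InImage-laplacian j)

  vertex : ∀ {a} → a ≤ N → Fin (suc N)
  vertex a≤N = fromℕ< (s≤s a≤N)

  coefficient : ∀ {i j} → i ≡ j → i · t₀ ≋ j · t₀
  coefficient refl = ≗⇒≋ (λ _ → refl)

  step-flat : ∀ {a} → a < N → ¬ (2 ℕ.+ a ≤ k) → δ (suc a) ⊖ δ a ≋ (λ _ → 0ℤ)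
  step-flat {a} a<N flat = ≋-by-image (- 1ℤ)
    (InImage-resp (fire-forward v (FinP.toℕ-fromℕ< _) a<N flat) (fire-in-image v))
    (λ p → reverse (δ a p) (δ (suc a) p))
    where
    v = vertex (ℕP.<⇒≤ a<N)
    reverse : ∀ x y → (y - x) - 0ℤ ≡ - 1ℤ * (x - y)
    reverse = solve-∀

  step-rise : ∀ {a} → 2 ℕ.+ a ≤ k → δ (suc a) ⊖ δ a ≋ δ a ⊖ δ (prevℕ N a)
  step-rise {a} rise = ≋-by-image (- 1ℤ)
    (InImage-resp (fire-both v (FinP.toℕ-fromℕ< _) rise) (fire-in-image v))
    (λ p → balance (δ a p) (δ (suc a) p) (δ (prevℕ N a) p))
    where
    v = vertex (ℕP.<⇒≤ (ℕP.≤-pred (ℕP.≤-trans rise k≤1+N)))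
    balance : ∀ x y z → (y - x) - (x - z) ≡ - 1ℤ * ((x - y) + (x - z))
    balance = solve-∀

  step : ∀ a → a < N → δ (suc a) ⊖ δ a ≋ increment a · t₀
  step a a<N with 2 ℕ.+ a ℕ.≤? k
  ... | no flat = ≋-trans (step-flat a<N flat) (coefficient (sym (increment-flat flat)))
  step zero _ | yes rise = ≋-trans (step-rise rise)
    (≋-trans (≗⇒≋ (λ p → sym (ℤP.*-identityˡ (t₀ p)))) (coefficient (sym (increment-rise rise))))
  step (suc b) 1+b<N | yes rise = ≋-trans (step-rise rise)
    (≋-trans (step b (ℕP.<-trans (ℕP.n<1+n b) 1+b<N))
      (coefficient (trans (increment-rise (ℕP.≤-trans (ℕP.n≤1+n _) rise)) (sym (increment-rise rise)))))

  unit-congruence : ∀ a → a ≤ N → δ a ⊖ δ N ≋ + weight a · t₀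
  unit-congruence zero _ =
    ≗⇒≋ (λ p → sym (trans (cong (λ u → + u * t₀ p) (weight-below 1≤k)) (ℤP.*-identityˡ (t₀ p))))
  unit-congruence (suc b) 1+b≤N = begin
    δ (suc b) ⊖ δ N
      ≈⟨ ≗⇒≋ (λ p → telescope (δ (suc b) p) (δ b p) (δ N p)) ⟩
    (δ b ⊖ δ N) ⊕ (δ (suc b) ⊖ δ b)
      ≈⟨ ⊕-cong (unit-congruence b (ℕP.<⇒≤ 1+b≤N)) (step b 1+b≤N) ⟩
    (+ weight b · t₀) ⊕ (increment b · t₀)
      ≈⟨ ≗⇒≋ (λ p → collect (+ weight b) (+ weight (suc b)) (t₀ p)) ⟩
    + weight (suc b) · t₀
      ∎
    where
    open SetoidReasoning ≋-setoid
    telescope : ∀ y x z → y - z ≡ (x - z) + (y - x)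
    telescope = solve-∀
    collect : ∀ u v t → u * t + (v - u) * t ≡ v * t
    collect = solve-∀

  k·t₀≋0 : + k · t₀ ≋ (λ _ → 0ℤ)
  k·t₀≋0 = begin
    + k · t₀          ≈⟨ coefficient (cong +_ (sym (weight-above k≤1+N))) ⟩
    + weight N · t₀   ≈⟨ ≋-sym (unit-congruence N ℕP.≤-refl) ⟩
    δ N ⊖ δ N         ≈⟨ ≗⇒≋ (ℤP.+-inverseʳ ∘ δ N) ⟩
    (λ _ → 0ℤ)        ∎
    where open SetoidReasoning ≋-setoid

  decomposition : ∀ x → x ≋ (sum x · δ N) ⊕ (⟨ w , x ⟩ · t₀)
  decomposition x = begin
    x                                        ≈⟨ ≗⇒≋ (basis-expansion x) ⟩
    combination x (δ ∘ toℕ)                  ≈⟨ combination-cong x vertex-class ⟩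
    combination x (λ i → δ N ⊕ (w i · t₀))   ≈⟨ ≗⇒≋ (combination-affine x w (δ N) t₀) ⟩
    (sum x · δ N) ⊕ (⟨ w , x ⟩ · t₀)         ∎
    where
    open SetoidReasoning ≋-setoid
    shift : ∀ x y → x ≡ y + (x - y)
    shift = solve-∀
    vertex-class : ∀ i → δ (toℕ i) ≋ δ N ⊕ (w i · t₀)
    vertex-class i = begin
      δ (toℕ i)                 ≈⟨ ≗⇒≋ (λ p → shift (δ (toℕ i) p) (δ N p)) ⟩
      δ N ⊕ (δ (toℕ i) ⊖ δ N)   ≈⟨ ⊕-cong {δ N} (≗⇒≋ (λ _ → refl))
                                     (unit-congruence (toℕ i) (ℕP.≤-pred (FinP.toℕ<n i))) ⟩
      δ N ⊕ (w i · t₀)          ∎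

  character⇒image : ∀ {x} → sum x ≡ 0ℤ → + k ∣ ⟨ w , x ⟩ → InImage cycle x
  character⇒image {x} sum≡0 (divides q wx≡qk) = ≋0⇒InImage (begin
    x                                  ≈⟨ decomposition x ⟩
    (sum x · δ N) ⊕ (⟨ w , x ⟩ · t₀)   ≈⟨ ≗⇒≋ (λ p → trans (cong₂ (λ s u → s * δ N p + u * t₀ p) sum≡0 wx≡qk)
                                                         (regroup q (+ k) (δ N p) (t₀ p))) ⟩
    q · (+ k · t₀)                     ≈⟨ ·-cong q k·t₀≋0 ⟩
    q · (λ _ → 0ℤ)                     ≈⟨ ≗⇒≋ (λ _ → ℤP.*-zeroʳ q) ⟩
    (λ _ → 0ℤ)                         ∎)
    where
    open SetoidReasoning ≋-setoid
    regroup : ∀ q k d t → 0ℤ * d + (q * k) * t ≡ q * (k * t)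
    regroup = solve-∀

  onto : ∀ a b → Σ (ℤ^ (suc N)) λ x → sum x ≡ a × + k ∣ ⟨ w , x ⟩ - b
  onto a b = x , sum-x , divides (a - b) weighted-x
    where
    open ≡-Reasoning
    first last x : ℤ^ (suc N)
    first = δ 0
    last  = δ N
    x = (b · first) ⊕ ((a - b) · last)
    pair : (f : ℤ^ (suc N)) → ⟨ f , x ⟩ ≡ b * ⟨ f , first ⟩ + (a - b) * ⟨ f , last ⟩
    pair f = trans (⟨⟩-⊕ f (b · first) ((a - b) · last))
                   (cong₂ _+_ (⟨⟩-· f b first) (⟨⟩-· f (a - b) last))
    sum-x : sum x ≡ a
    sum-x = begin
      sum x
        ≡⟨ sum≡⟨𝟙,⟩ x ⟩
      ⟨ 𝟙 , x ⟩
        ≡⟨ pair 𝟙 ⟩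
      b * ⟨ 𝟙 , first ⟩ + (a - b) * ⟨ 𝟙 , last ⟩
        ≡⟨ cong₂ (λ u v → b * u + (a - b) * v)
             (⟨⟩-δ {suc N} {0} 𝟙 (s≤s z≤n)) (⟨⟩-δ {suc N} {N} 𝟙 (s≤s ℕP.≤-refl)) ⟩
      b * 1ℤ + (a - b) * 1ℤ
        ≡⟨ recombine a b ⟩
      a
        ∎
      where
      recombine : ∀ a b → b * 1ℤ + (a - b) * 1ℤ ≡ a
      recombine = solve-∀
    weighted-x : ⟨ w , x ⟩ - b ≡ (a - b) * + k
    weighted-x = begin
      ⟨ w , x ⟩ - b
        ≡⟨ cong (_- b) (pair w) ⟩
      b * ⟨ w , first ⟩ + (a - b) * ⟨ w , last ⟩ - b
        ≡⟨ cong₂ (λ u v → b * u + (a - b) * v - b) (⟨w,δ⟩ z≤n) (⟨w,δ⟩ ℕP.≤-refl) ⟩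
      b * + weight 0 + (a - b) * + weight N - b
        ≡⟨ cong₂ (λ u v → b * + u + (a - b) * + v - b) (weight-below 1≤k) (weight-above k≤1+N) ⟩
      b * 1ℤ + (a - b) * + k - b
        ≡⟨ cancel a b (+ k) ⟩
      (a - b) * + k
        ∎
      where
      cancel : ∀ a b k → b * 1ℤ + (a - b) * k - b ≡ (a - b) * k
      cancel = solve-∀

  picIso : PicIso cycle k
  picIso = picIso-from-character cycle k (ℕP.>⇒≢ 1≤k) w image⇒character character⇒image onto

theorem4p1 : (n k : ℕ) → 3 ≤ n → 1 ≤ k → k ≤ n →
    Σ (DirCycle n) λ c → PicIso c k
theorem4p1 (suc zero)    _ (s≤s ()) _   _
theorem4p1 (suc (suc N)) k _        1≤k k≤n = cycle , picIso
  where open Construction (suc N) k (s≤s z≤n) 1≤k k≤n
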